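{- If $a,b,c,d$ are positive integers such that $ad - bc = 1$, then \begin{align*} &(u-1) \left( u^a v^b -1 \right) \mathrm{c}\left( v, u; d,c \right) + (v-1) \left( u^c v^d -1 \right) \mathrm{c}\left( u,v; a,b \right) \\ &\qquad = u^{a+c-1} v^{b+d-1} - u^a v^b -u^c v^d + u^{a-1} v^b + u^c v^{d-1} - u^{a-1} v^{b-1} - u^{c-1} v^{d-1} +1 . \end{align*}
   Context: For positive integers $a,b$ and indeterminates $u,v$, the Dedekind--Carlitz polynomial is $\mathrm{c}(u,v;a,b) := \sum_{k=1}^{b-1} u^{\lfloor ka/b\rfloor} v^{k-1}$. -}

module Defs where

open import Level using (Level)
open import Data.Nat using (ℕ; zero; suc) renaming (_*_ to _*ℕ_; _/_ to _/ℕ_)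
open import Algebra.Bundles using (CommutativeRing; Semiring)
import Algebra.Definitions.RawSemiring as RS

-- Dedekind–Carlitz polynomial, evaluated in an arbitrary commutative ring R
--   c(u,v;a,b) = Σ_{k=1}^{b-1} u^⌊ka/b⌋ v^(k-1)
-- (for b = 0 the range is empty and the value is 0).
module _ {c ℓ : Level} (R : CommutativeRing c ℓ) where
  open CommutativeRing R
  open RS (Semiring.rawSemiring semiring) using (_^_)

  pow : Carrier → ℕ → Carrier
  pow = _^_

  dcSum : Carrier → Carrier → ℕ → ℕ → ℕ → Carrier
  dcSum u v a b' zero    = 0#
  dcSum u v a b' (suc m) =
    dcSum u v a b' m + (u ^ ((suc m *ℕ a) /ℕ suc b')) * (v ^ m)

  dc : Carrier → Carrier → ℕ → ℕ → Carrier
  dc u v a zero       = 0#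
  dc u v a (suc b')   = dcSum u v a b' b'

module Submission where

open import Defs
open import Level using (Level; 0ℓ)
open import Data.Nat using (ℕ; _<_; _∸_) renaming (_+_ to _+ℕ_; _*_ to _*ℕ_)
open import Data.Nat using (suc)
open import Relation.Binary.PropositionalEquality using (_≡_)
open import Algebra.Bundles using (CommutativeRing; RawRing)

-- Write a = a₀+1, …, d = d₀+1.  The statement is proved simultaneously with
-- Carlitz's reciprocity law  (v-1) c(u,v;a,b) + (u-1) c(v,u;b,a) = u^(a-1) v^(b-1) - 1
-- for the two pairs (a,b) and (c,d), by induction along the Stern–Brocot tree:
--  * every pair a/b > c/d with ad - bc = 1 is reached from n+1 > n or 1/n > 1/(n+1)
--    by repeatedly replacing one member of the pair with the mediant (a+c)/(b+d)
--    (module SternBrocotPairs);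
--  * the floors ⌊k(a+c)/(b+d)⌋ are those of c/d and a/b glued together (module
--    MediantFloors), so c(u,v;a+c,b+d) = c(u,v;c,d) + uᶜv^(d-1) (1 + v c(u,v;a,b));
--  * each identity says that a polynomial "defect" vanishes (module Defects), and
--    the defects of the new pairs are explicit combinations of the old ones, which
--    the ring solver checks; the base cases reduce to geometric sums.

module IntegerCoefficients {c ℓ : Level} (R : CommutativeRing c ℓ) where
  open import Data.Nat as ℕ using (zero)
  open import Data.Integer as ℤ using (ℤ; +_; -[1+_]; _⊖_; _◃_; sign; ∣_∣)
  import Data.Integer.Properties as ℤ
  import Data.Nat.Properties as ℕ
  open import Data.Sign as Sign using (Sign)
  open import Data.Maybe using (just; nothing)
  open import Relation.Binary.Definitions using (WeaklyDecidable)
  import Relation.Binary.PropositionalEquality as ≡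
  open import Relation.Nullary using (yes; no)
  open import Algebra.Solver.Ring.AlmostCommutativeRing
    using (fromCommutativeRing; _-Raw-AlmostCommutative⟶_; Induced-equivalence)
  open CommutativeRing R
  open import Algebra.Properties.Ring ring using (-‿+-comm; -0#≈0#; -‿involutive; -1*x≈-x)
  open import Algebra.Properties.Semiring.Mult.TCOptimised semiring
    using (_×_; 1+×; ×-homo-+; ×1-homo-*)
  open import Algebra.Properties.CommutativeSemigroup *-commutativeSemigroup
    using () renaming (interchange to *-interchange)
  open import Relation.Binary.Reasoning.Setoid setoid

  -- The canonical map ℤ → R; the optimised multiplication makes
  -- fromℤ (+ 1) = 1# and fromℤ -[1+ 0 ] = - 1# hold definitionally.
  fromℤ : ℤ → Carrier
  fromℤ (+ n)      = n × 1#
  fromℤ -[1+ n ]   = - (suc n × 1#)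

  fromSign : Sign → Carrier
  fromSign Sign.+ = 1#
  fromSign Sign.- = - 1#

  fromℤ-⊖ : ∀ m n → fromℤ (m ⊖ n) ≈ m × 1# - n × 1#
  fromℤ-⊖ zero    zero    = sym (-‿inverseʳ 0#)
  fromℤ-⊖ (suc m) zero    = sym (trans (+-congˡ -0#≈0#) (+-identityʳ _))
  fromℤ-⊖ zero    (suc n) = sym (+-identityˡ _)
  fromℤ-⊖ (suc m) (suc n) = begin
    fromℤ (suc m ⊖ suc n)          ≡⟨ ≡.cong fromℤ (ℤ.[1+m]⊖[1+n]≡m⊖n m n) ⟩
    fromℤ (m ⊖ n)                  ≈⟨ fromℤ-⊖ m n ⟩
    m × 1# - n × 1#                ≈⟨ cancel (m × 1#) (n × 1#) ⟨
    (1# + m × 1#) - (1# + n × 1#)  ≈⟨ +-cong (1+× m 1#) (-‿cong (1+× n 1#)) ⟨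
    suc m × 1# - suc n × 1#        ∎
    where
    cancel : ∀ x y → (1# + x) - (1# + y) ≈ x - y
    cancel x y = begin
      (1# + x) + - (1# + y)     ≈⟨ +-cong (+-comm x 1#) (-‿+-comm 1# y) ⟨
      (x + 1#) + (- 1# + - y)   ≈⟨ +-assoc x 1# _ ⟩
      x + (1# + (- 1# + - y))   ≈⟨ +-congˡ (+-assoc 1# (- 1#) (- y)) ⟨
      x + ((1# + - 1#) + - y)   ≈⟨ +-congˡ (+-congʳ (-‿inverseʳ 1#)) ⟩
      x + (0# + - y)            ≈⟨ +-congˡ (+-identityˡ (- y)) ⟩
      x - y                     ∎

  fromℤ-+ : ∀ i j → fromℤ (i ℤ.+ j) ≈ fromℤ i + fromℤ j
  fromℤ-+ (+ m)    (+ n)    = ×-homo-+ 1# m n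
  fromℤ-+ (+ m)    -[1+ n ] = fromℤ-⊖ m (suc n)
  fromℤ-+ -[1+ m ] (+ n)    = trans (fromℤ-⊖ n (suc m)) (+-comm _ _)
  fromℤ-+ -[1+ m ] -[1+ n ] = begin
    - (suc (suc (m ℕ.+ n)) × 1#)   ≡⟨ ≡.cong (λ k → - (suc k × 1#)) (ℕ.+-suc m n) ⟨
    - ((suc m ℕ.+ suc n) × 1#)     ≈⟨ -‿cong (×-homo-+ 1# (suc m) (suc n)) ⟩
    - (suc m × 1# + suc n × 1#)    ≈⟨ -‿+-comm _ _ ⟨
    - (suc m × 1#) + - (suc n × 1#) ∎

  fromℤ-neg : ∀ i → fromℤ (ℤ.- i) ≈ - fromℤ i
  fromℤ-neg (+ zero)  = sym -0#≈0#
  fromℤ-neg (+ suc n) = refl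
  fromℤ-neg -[1+ n ]  = sym (-‿involutive _)

  -- Multiplicativity goes through the sign/absolute-value decomposition
  -- by which ℤ multiplication is defined.
  fromSign-* : ∀ s t → fromSign (s Sign.* t) ≈ fromSign s * fromSign t
  fromSign-* Sign.+ t      = sym (*-identityˡ _)
  fromSign-* Sign.- Sign.+ = sym (*-identityʳ _)
  fromSign-* Sign.- Sign.- = begin
    1#             ≈⟨ -‿involutive 1# ⟨
    - - 1#         ≈⟨ -1*x≈-x (- 1#) ⟨
    - 1# * - 1#    ∎

  fromℤ-◃ : ∀ s n → fromℤ (s ◃ n) ≈ fromSign s * (n × 1#)
  fromℤ-◃ s      zero    = sym (zeroʳ _)
  fromℤ-◃ Sign.+ (suc n) = sym (*-identityˡ _)
  fromℤ-◃ Sign.- (suc n) = sym (-1*x≈-x _)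

  fromℤ-signAbs : ∀ i → fromℤ i ≈ fromSign (sign i) * (∣ i ∣ × 1#)
  fromℤ-signAbs i = trans (reflexive (≡.cong fromℤ (≡.sym (ℤ.◃-inverse i)))) (fromℤ-◃ (sign i) ∣ i ∣)

  fromℤ-* : ∀ i j → fromℤ (i ℤ.* j) ≈ fromℤ i * fromℤ j
  fromℤ-* i j = begin
    fromℤ ((sign i Sign.* sign j) ◃ (∣ i ∣ ℕ.* ∣ j ∣))
      ≈⟨ fromℤ-◃ (sign i Sign.* sign j) (∣ i ∣ ℕ.* ∣ j ∣) ⟩
    fromSign (sign i Sign.* sign j) * ((∣ i ∣ ℕ.* ∣ j ∣) × 1#)
      ≈⟨ *-cong (fromSign-* (sign i) (sign j)) (×1-homo-* ∣ i ∣ ∣ j ∣) ⟩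
    (fromSign (sign i) * fromSign (sign j)) * ((∣ i ∣ × 1#) * (∣ j ∣ × 1#))
      ≈⟨ *-interchange _ _ _ _ ⟩
    (fromSign (sign i) * (∣ i ∣ × 1#)) * (fromSign (sign j) * (∣ j ∣ × 1#))
      ≈⟨ *-cong (fromℤ-signAbs i) (fromℤ-signAbs j) ⟨
    fromℤ i * fromℤ j ∎

  -- Equality of integer coefficients is decidable, so the solver can
  -- recognise vanishing coefficients.
  fromℤ-homomorphism : ℤ.+-*-rawRing -Raw-AlmostCommutative⟶ fromCommutativeRing R
  fromℤ-homomorphism = record
    { ⟦_⟧    = fromℤ
    ; +-homo = fromℤ-+
    ; *-homo = fromℤ-*
    ; -‿homo = fromℤ-neg
    ; 0-homo = refl
    ; 1-homo = refl
    }

  equal-coefficients? : WeaklyDecidable (Induced-equivalence fromℤ-homomorphism)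
  equal-coefficients? i j with i ℤ.≟ j
  ... | yes ≡.refl = just refl
  ... | no _       = nothing

  open import Algebra.Solver.Ring ℤ.+-*-rawRing (fromCommutativeRing R)
    fromℤ-homomorphism equal-coefficients? public

  -- Solver expressions in n variables form a raw ring, so that
  -- expressions defined over an arbitrary raw ring can be instantiated
  -- both in R and in solver syntax.
  expressions : ℕ → RawRing 0ℓ 0ℓ
  expressions n = record
    { Carrier = Polynomial n
    ; _≈_     = _≡_
    ; _+_     = _:+_
    ; _*_     = _:*_
    ; -_      = :-_
    ; 0#      = con (+ 0)
    ; 1#      = con (+ 1)
    }

-- The identities of the development, each written as "defect = 0".  The
-- defects are defined over an arbitrary raw ring, so that the same definition
-- is evaluated in R and written as a solver expression.
module Defects {a ℓ : Level} (S : RawRing a ℓ) where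
  open RawRing S

  private
    infixl 6 _-_
    _-_ : Carrier → Carrier → Carrier
    x - y = x + - y

  -- (V - 1) G = P - 1, for G = 1 + V + … + V^(n-1) and P = Vⁿ.
  geometricDefect : (V P G : Carrier) → Carrier
  geometricDefect V P G = (V - 1#) * G - (P - 1#)

  -- Reciprocity for the pair (a,b): A = u^(a-1), B = v^(b-1),
  -- X = c(u,v;a,b), Y = c(v,u;b,a).
  recipDefect : (u v A B X Y : Carrier) → Carrier
  recipDefect u v A B X Y = (v - 1#) * X + (u - 1#) * Y - (A * B - 1#)

  -- Right-hand side of Corollary 10, with leading term F = u^(a+c-1) v^(b+d-1)
  -- and C = u^(c-1), D = v^(d-1).
  crossRHS : (F u v A B C D : Carrier) → Carrier
  crossRHS F u v A B C D =
    F - (u * A) * (v * B) - (u * C) * (v * D)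
      + A * (v * B) + (u * C) * D - A * B - C * D + 1#

  -- Corollary 10 for the pairs (a,b), (c,d): X = c(u,v;a,b), Y = c(v,u;d,c).
  crossDefect : (u v A B C D X Y : Carrier) → Carrier
  crossDefect u v A B C D X Y =
    (u - 1#) * ((u * A) * (v * B) - 1#) * Y + (v - 1#) * ((u * C) * (v * D) - 1#) * X
      - crossRHS ((A * (u * C)) * (B * (v * D))) u v A B C D

module MediantFloors where
  open import Data.Nat
  open import Data.Nat.Properties
  open import Data.Nat.DivMod
  open import Data.Nat.Divisibility using (divides-refl)
  open import Data.Nat.Tactic.RingSolver using (solve)
  open import Data.List using ([]; _∷_)
  open import Relation.Binary.PropositionalEquality
  open import Algebra.Properties.CommutativeSemigroup *-commutativeSemigroup using (xy∙z≈xz∙y)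

  quotient-unique : ∀ {n m q} .{{_ : NonZero m}} → q * m ≤ n → n < suc q * m → n / m ≡ q
  quotient-unique {n} {m} {q} lower upper = ≤-antisym (s≤s⁻¹ (m<n*o⇒m/o<n upper)) (begin
    q          ≡⟨ m*n/n≡m q m ⟨
    q * m / m  ≤⟨ /-monoˡ-≤ m lower ⟩
    n / m      ∎)
    where open ≤-Reasoning

  -- Comparing two fractions: if  N/M = n/m + (r - s)/(mM)  with  0 ≤ r - s  and
  -- r < M, the fraction N/M lies in [n/m, ⌊n/m⌋ + 1), so it has the same floor.
  floor-stable : ∀ N M n m {r s} .{{_ : NonZero M}} .{{_ : NonZero m}} →
    s ≤ r → r < M → N * m + s ≡ n * M + r → N / M ≡ n / m
  floor-stable N M n m {r} {s} s≤r r<M eq =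
    quotient-unique (*-cancelʳ-≤ (q * M) N m lower) (*-cancelʳ-< m N (suc q * M) upper)
    where
    open ≤-Reasoning
    q : ℕ
    q = n / m
    nM≤Nm : n * M ≤ N * m
    nM≤Nm = +-cancelʳ-≤ s (n * M) (N * m) (begin
      n * M + s  ≤⟨ +-monoʳ-≤ (n * M) s≤r ⟩
      n * M + r  ≡⟨ eq ⟨
      N * m + s  ∎)
    lower : q * M * m ≤ N * m
    lower = begin
      q * M * m  ≡⟨ xy∙z≈xz∙y q M m ⟩
      q * m * M  ≤⟨ *-monoˡ-≤ M (m/n*n≤m n m) ⟩
      n * M      ≤⟨ nM≤Nm ⟩
      N * m      ∎
    n<[1+q]m : n < suc q * m
    n<[1+q]m = begin-strict
      n              ≡⟨ m≡m%n+[m/n]*n n m ⟩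
      n % m + q * m  <⟨ +-monoˡ-< (q * m) (m%n<n n m) ⟩
      m + q * m      ∎
    upper : N * m < suc q * M * m
    upper = begin-strict
      N * m          ≤⟨ m≤m+n (N * m) s ⟩
      N * m + s      ≡⟨ eq ⟩
      n * M + r      <⟨ +-monoʳ-< (n * M) r<M ⟩
      n * M + M      ≡⟨ +-comm (n * M) M ⟩
      suc n * M      ≤⟨ *-monoˡ-≤ M n<[1+q]m ⟩
      suc q * m * M  ≡⟨ xy∙z≈xz∙y (suc q) m M ⟩
      suc q * M * m  ∎

  -- Let s = s₁/S₂ and l = l₁/L₂ be Farey neighbours, l₁S₂ = L₂s₁ + 1, and let
  -- k be an index.  The next two identities compare the k-th multiples of the
  -- mediant (s₁+l₁)/(S₂+L₂) with those of s, respectively of l shifted by S₂.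
  mediant-head-identity : ∀ s₁ S₂ l₁ L₂ k → l₁ * S₂ ≡ L₂ * s₁ + 1 →
    k * (s₁ + l₁) * S₂ + 0 ≡ k * s₁ * (S₂ + L₂) + k
  mediant-head-identity s₁ S₂ l₁ L₂ k unimodular = begin
    k * (s₁ + l₁) * S₂ + 0          ≡⟨ solve (k ∷ s₁ ∷ l₁ ∷ S₂ ∷ []) ⟩
    k * s₁ * S₂ + k * (l₁ * S₂)     ≡⟨ cong (λ x → k * s₁ * S₂ + k * x) unimodular ⟩
    k * s₁ * S₂ + k * (L₂ * s₁ + 1) ≡⟨ solve (k ∷ s₁ ∷ S₂ ∷ L₂ ∷ []) ⟩
    k * s₁ * (S₂ + L₂) + k          ∎
    where open ≡-Reasoning

  mediant-tail-identity : ∀ s₁ S₂ l₁ L₂ k → l₁ * S₂ ≡ L₂ * s₁ + 1 →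
    (S₂ + k) * (s₁ + l₁) * L₂ + k ≡ (s₁ * L₂ + k * l₁) * (S₂ + L₂) + L₂
  mediant-tail-identity s₁ S₂ l₁ L₂ k unimodular = begin
    (S₂ + k) * (s₁ + l₁) * L₂ + k
      ≡⟨ solve (S₂ ∷ k ∷ s₁ ∷ l₁ ∷ L₂ ∷ []) ⟩
    s₁ * S₂ * L₂ + k * s₁ * L₂ + k * l₁ * L₂ + k + L₂ * (l₁ * S₂)
      ≡⟨ cong (λ x → s₁ * S₂ * L₂ + k * s₁ * L₂ + k * l₁ * L₂ + k + L₂ * x) unimodular ⟩
    s₁ * S₂ * L₂ + k * s₁ * L₂ + k * l₁ * L₂ + k + L₂ * (L₂ * s₁ + 1)
      ≡⟨ solve (s₁ ∷ S₂ ∷ L₂ ∷ k ∷ l₁ ∷ []) ⟩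
    s₁ * S₂ * L₂ + s₁ * L₂ * L₂ + k * l₁ * L₂ + L₂ + k * (L₂ * s₁ + 1)
      ≡⟨ cong (λ x → s₁ * S₂ * L₂ + s₁ * L₂ * L₂ + k * l₁ * L₂ + L₂ + k * x) unimodular ⟨
    s₁ * S₂ * L₂ + s₁ * L₂ * L₂ + k * l₁ * L₂ + L₂ + k * (l₁ * S₂)
      ≡⟨ solve (s₁ ∷ S₂ ∷ L₂ ∷ k ∷ l₁ ∷ []) ⟩
    (s₁ * L₂ + k * l₁) * (S₂ + L₂) + L₂ ∎
    where open ≡-Reasoning

  floor-mediant-head : ∀ s₁ s₂ l₁ L₂ k → l₁ * suc s₂ ≡ L₂ * s₁ + 1 → k < suc s₂ →
    k * (s₁ + l₁) / (suc s₂ + L₂) ≡ k * s₁ / suc s₂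
  floor-mediant-head s₁ s₂ l₁ L₂ k unimodular k<S₂ =
    floor-stable (k * (s₁ + l₁)) (suc s₂ + L₂) (k * s₁) (suc s₂) z≤n (≤-trans k<S₂ (m≤m+n (suc s₂) L₂))
      (mediant-head-identity s₁ (suc s₂) l₁ L₂ k unimodular)

  floor-mediant-tail : ∀ s₁ s₂ l₁ l₂ k → l₁ * suc s₂ ≡ suc l₂ * s₁ + 1 → k < suc l₂ →
    (suc s₂ + k) * (s₁ + l₁) / (suc s₂ + suc l₂) ≡ s₁ + k * l₁ / suc l₂
  floor-mediant-tail s₁ s₂ l₁ l₂ k unimodular k<L₂ = begin
    (suc s₂ + k) * (s₁ + l₁) / (suc s₂ + suc l₂)
      ≡⟨ floor-stable ((suc s₂ + k) * (s₁ + l₁)) (suc s₂ + suc l₂) (s₁ * suc l₂ + k * l₁) (suc l₂)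
           (<⇒≤ k<L₂) (m<n+m (suc l₂) z<s)
           (mediant-tail-identity s₁ (suc s₂) l₁ (suc l₂) k unimodular) ⟩
    (s₁ * suc l₂ + k * l₁) / suc l₂        ≡⟨ +-distrib-/-∣ˡ (k * l₁) (divides-refl s₁) ⟩
    s₁ * suc l₂ / suc l₂ + k * l₁ / suc l₂ ≡⟨ cong (_+ k * l₁ / suc l₂) (m*n/n≡m s₁ (suc l₂)) ⟩
    s₁ + k * l₁ / suc l₂                   ∎
    where open ≡-Reasoning

module SternBrocotPairs where
  open import Data.Nat
  open import Data.Nat.Properties
  open import Data.Nat.Tactic.RingSolver using (solve)
  open import Data.List using ([]; _∷_)
  open import Data.Product using (_×_; _,_)
  open import Data.Empty using (⊥-elim)
  open import Relation.Binary.PropositionalEquality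

  -- (a₀+1)/(b₀+1) and (c₀+1)/(d₀+1) are Farey neighbours, the first one larger.
  Unimodular : ℕ → ℕ → ℕ → ℕ → Set
  Unimodular a₀ b₀ c₀ d₀ = suc a₀ * suc d₀ ≡ suc b₀ * suc c₀ + 1

  -- Derivations of neighbour pairs in the Stern–Brocot tree: start from n/1 < (n+1)/1
  -- or 1/(n+1) < 1/n and repeatedly replace one member of the pair by the mediant.
  data SternBrocot : ℕ → ℕ → ℕ → ℕ → Set where
    integers       : ∀ n → SternBrocot (suc n) 0 n 0
    unit-fractions : ∀ n → SternBrocot 0 n 0 (suc n)
    mediant-left   : ∀ {a₀ b₀ c₀ d₀} → Unimodular a₀ b₀ c₀ d₀ → SternBrocot a₀ b₀ c₀ d₀ →
                     SternBrocot (suc (c₀ + a₀)) (suc (d₀ + b₀)) c₀ d₀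
    mediant-right  : ∀ {a₀ b₀ c₀ d₀} → Unimodular a₀ b₀ c₀ d₀ → SternBrocot a₀ b₀ c₀ d₀ →
                     SternBrocot a₀ b₀ (suc (c₀ + a₀)) (suc (d₀ + b₀))

  unimodular-left : ∀ a₀ b₀ c₀ d₀ →
    Unimodular (suc (c₀ + a₀)) (suc (d₀ + b₀)) c₀ d₀ → Unimodular a₀ b₀ c₀ d₀
  unimodular-left a₀ b₀ c₀ d₀ det = +-cancelˡ-≡ (suc c₀ * suc d₀) _ _ (begin
    suc c₀ * suc d₀ + suc a₀ * suc d₀         ≡⟨ solve (c₀ ∷ a₀ ∷ d₀ ∷ []) ⟩
    suc (suc (c₀ + a₀)) * suc d₀              ≡⟨ det ⟩
    suc (suc (d₀ + b₀)) * suc c₀ + 1          ≡⟨ solve (d₀ ∷ b₀ ∷ c₀ ∷ []) ⟩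
    suc c₀ * suc d₀ + (suc b₀ * suc c₀ + 1)   ∎)
    where open ≡-Reasoning

  unimodular-right : ∀ a₀ b₀ c₀ d₀ →
    Unimodular a₀ b₀ (suc (a₀ + c₀)) (suc (b₀ + d₀)) → Unimodular a₀ b₀ c₀ d₀
  unimodular-right a₀ b₀ c₀ d₀ det = +-cancelˡ-≡ (suc a₀ * suc b₀) _ _ (begin
    suc a₀ * suc b₀ + suc a₀ * suc d₀         ≡⟨ solve (a₀ ∷ b₀ ∷ d₀ ∷ []) ⟩
    suc a₀ * suc (suc (b₀ + d₀))              ≡⟨ det ⟩
    suc b₀ * suc (suc (a₀ + c₀)) + 1          ≡⟨ solve (b₀ ∷ a₀ ∷ c₀ ∷ []) ⟩
    suc a₀ * suc b₀ + (suc b₀ * suc c₀ + 1)   ∎)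
    where open ≡-Reasoning

  -- In the degenerate cases the remaining difference must be the pair 1/1.
  unit-product : ∀ m n → suc m * suc n ≡ 1 → m ≡ 0 × n ≡ 0
  unit-product m n eq =
    suc-injective (m*n≡1⇒m≡1 (suc m) (suc n) eq) , suc-injective (m*n≡1⇒n≡1 (suc m) (suc n) eq)

  degenerate-left : ∀ c₀ d₀ k → Unimodular (suc (c₀ + k)) d₀ c₀ d₀ → k ≡ 0 × d₀ ≡ 0
  degenerate-left c₀ d₀ k det = unit-product k d₀ (+-cancelˡ-≡ (suc c₀ * suc d₀) _ _ (begin
    suc c₀ * suc d₀ + suc k * suc d₀   ≡⟨ solve (c₀ ∷ k ∷ d₀ ∷ []) ⟩
    suc (suc (c₀ + k)) * suc d₀        ≡⟨ det ⟩
    suc d₀ * suc c₀ + 1                ≡⟨ solve (d₀ ∷ c₀ ∷ []) ⟩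
    suc c₀ * suc d₀ + 1                ∎))
    where open ≡-Reasoning

  degenerate-right : ∀ a₀ b₀ e → Unimodular a₀ b₀ a₀ (suc (b₀ + e)) → a₀ ≡ 0 × e ≡ 0
  degenerate-right a₀ b₀ e det = unit-product a₀ e (+-cancelˡ-≡ (suc a₀ * suc b₀) _ _ (begin
    suc a₀ * suc b₀ + suc a₀ * suc e   ≡⟨ solve (a₀ ∷ b₀ ∷ e ∷ []) ⟩
    suc a₀ * suc (suc (b₀ + e))        ≡⟨ det ⟩
    suc b₀ * suc a₀ + 1                ≡⟨ solve (b₀ ∷ a₀ ∷ []) ⟩
    suc a₀ * suc b₀ + 1                ∎))
    where open ≡-Reasoning

  crossing-below : ∀ a b c d → a ≤ c → d ≤ b → a * d ≢ b * c + 1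
  crossing-below a b c d a≤c d≤b eq = <-irrefl eq (begin-strict
    a * d      ≤⟨ *-mono-≤ a≤c d≤b ⟩
    c * b      ≡⟨ *-comm c b ⟩
    b * c      <⟨ m<m+n (b * c) z<s ⟩
    b * c + 1  ∎)
    where open ≤-Reasoning

  crossing-above : ∀ a b c d → 0 < c → c < a → b < d → a * d ≢ b * c + 1
  crossing-above a b c d 0<c c<a b<d eq = <-irrefl (sym eq) (begin-strict
    b * c + 1            <⟨ m<m+n (b * c + 1) (≤-trans 0<c (m≤n+m c b)) ⟩
    b * c + 1 + (b + c)  ≡⟨ solve (b ∷ c ∷ []) ⟩
    suc c * suc b        ≤⟨ *-mono-≤ c<a b<d ⟩
    a * d                ∎)
    where open ≤-Reasoning

  -- The base cases, in the shape in which the descent meets them.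
  integers′ : ∀ c₀ d₀ k → k ≡ 0 × d₀ ≡ 0 → SternBrocot (suc (c₀ + k)) d₀ c₀ d₀
  integers′ c₀ .0 .0 (refl , refl) =
    subst (λ x → SternBrocot (suc x) 0 c₀ 0) (sym (+-identityʳ c₀)) (integers c₀)

  unit-fractions′ : ∀ a₀ b₀ e → a₀ ≡ 0 × e ≡ 0 → SternBrocot a₀ b₀ a₀ (suc (b₀ + e))
  unit-fractions′ .0 b₀ .0 (refl , refl) =
    subst (λ x → SternBrocot 0 b₀ 0 (suc x)) (sym (+-identityʳ b₀)) (unit-fractions b₀)

  m≤1+m+k : ∀ m k → m ≤ suc (m + k)
  m≤1+m+k m k = m≤n⇒m≤1+n (m≤m+n m k)

  -- Every unimodular pair has a Stern–Brocot derivation, by descent on a₀ + c₀.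
  -- Compare the pairs coordinatewise: if one dominates in both coordinates it is
  -- the mediant of the other and the difference; coordinates that are ordered
  -- the same way with one equality give the base pairs; crossings are impossible.
  sternBrocot-within : ∀ fuel a₀ b₀ c₀ d₀ → a₀ + c₀ < fuel →
    Unimodular a₀ b₀ c₀ d₀ → SternBrocot a₀ b₀ c₀ d₀
  sternBrocot-within (suc fuel) a₀ b₀ c₀ d₀ bound det with compare c₀ a₀ | compare d₀ b₀
  ... | less _ k | less _ e =
    mediant-left inner (sternBrocot-within fuel k e c₀ d₀ smaller inner)
    where
    inner : Unimodular k e c₀ d₀
    inner = unimodular-left k e c₀ d₀ det
    smaller : k + c₀ < fuel
    smaller = <-≤-trans (s≤s (+-monoˡ-≤ c₀ (m≤n+m k c₀))) (s≤s⁻¹ bound)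
  ... | less _ k | equal _ = integers′ c₀ d₀ k (degenerate-left c₀ d₀ k det)
  ... | less _ k | greater _ e =
    ⊥-elim (crossing-above (suc a₀) (suc b₀) (suc c₀) (suc d₀) z<s
      (s≤s (s≤s (m≤m+n c₀ k))) (s≤s (s≤s (m≤m+n b₀ e))) det)
  ... | equal _ | less _ e =
    ⊥-elim (crossing-below (suc a₀) (suc b₀) (suc c₀) (suc d₀) ≤-refl (s≤s (m≤1+m+k d₀ e)) det)
  ... | equal _ | equal _ =
    ⊥-elim (crossing-below (suc a₀) (suc b₀) (suc c₀) (suc d₀) ≤-refl ≤-refl det)
  ... | equal _ | greater _ e = unit-fractions′ a₀ b₀ e (degenerate-right a₀ b₀ e det)
  ... | greater _ k | less _ e =
    ⊥-elim (crossing-below (suc a₀) (suc b₀) (suc c₀) (suc d₀) (s≤s (m≤1+m+k a₀ k)) (s≤s (m≤1+m+k d₀ e)) det)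
  ... | greater _ k | equal _ =
    ⊥-elim (crossing-below (suc a₀) (suc b₀) (suc c₀) (suc d₀) (s≤s (m≤1+m+k a₀ k)) ≤-refl det)
  ... | greater _ k | greater _ e =
    subst₂ (SternBrocot a₀ b₀) (cong suc (+-comm k a₀)) (cong suc (+-comm e b₀))
      (mediant-right inner (sternBrocot-within fuel a₀ b₀ k e smaller inner))
    where
    inner : Unimodular a₀ b₀ k e
    inner = unimodular-right a₀ b₀ k e det
    smaller : a₀ + k < fuel
    smaller = ≤-trans (m≤n+m (suc (a₀ + k)) a₀) (s≤s⁻¹ bound)

  sternBrocot : ∀ a₀ b₀ c₀ d₀ → Unimodular a₀ b₀ c₀ d₀ → SternBrocot a₀ b₀ c₀ d₀
  sternBrocot a₀ b₀ c₀ d₀ = sternBrocot-within (suc (a₀ + c₀)) a₀ b₀ c₀ d₀ ≤-refl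

module DedekindCarlitz {c ℓ : Level} (R : CommutativeRing c ℓ) where
  open import Data.Nat as ℕ using (zero; suc; s≤s)
  import Data.Nat.Properties as ℕ
  open import Data.Nat.DivMod using (_/_; m<n⇒m/n≡0)
  open import Data.Integer using (+_)
  import Relation.Binary.PropositionalEquality as ≡
  open MediantFloors using (floor-mediant-head; floor-mediant-tail)
  open SternBrocotPairs using (Unimodular; SternBrocot; integers; unit-fractions; mediant-left; mediant-right)
  open CommutativeRing R
  open IntegerCoefficients R using (solve; _:=_; _:+_; _:*_; _:-_; con; expressions)
  open import Algebra.Properties.Semiring.Exp semiring using (^-homo-*)
  open import Algebra.Properties.CommutativeSemigroup *-commutativeSemigroup
    using (interchange; x∙yz≈y∙xz)
  open import Relation.Binary.Reasoning.Setoid setoid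
  open Defects rawRing
  private module E n = Defects (expressions n)

  infixr 8 _^_
  _^_ : Carrier → ℕ → Carrier
  _^_ = pow R

  ∑ : (ℕ → Carrier) → ℕ → Carrier
  ∑ f zero    = 0#
  ∑ f (suc n) = ∑ f n + f n

  ∑-cong : ∀ n {f g} → (∀ i → i < n → f i ≈ g i) → ∑ f n ≈ ∑ g n
  ∑-cong zero    f≈g = refl
  ∑-cong (suc n) f≈g = +-cong (∑-cong n (λ i i<n → f≈g i (ℕ.m<n⇒m<1+n i<n))) (f≈g n ℕ.≤-refl)

  ∑-split : ∀ m n f → ∑ f (m ℕ.+ n) ≈ ∑ f m + ∑ (λ i → f (m ℕ.+ i)) n
  ∑-split m zero    f = trans (reflexive (≡.cong (∑ f) (ℕ.+-identityʳ m))) (sym (+-identityʳ _))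
  ∑-split m (suc n) f = begin
    ∑ f (m ℕ.+ suc n)                                   ≡⟨ ≡.cong (∑ f) (ℕ.+-suc m n) ⟩
    ∑ f (m ℕ.+ n) + f (m ℕ.+ n)                         ≈⟨ +-congʳ (∑-split m n f) ⟩
    ∑ f m + ∑ (λ i → f (m ℕ.+ i)) n + f (m ℕ.+ n)       ≈⟨ +-assoc _ _ _ ⟩
    ∑ f m + (∑ (λ i → f (m ℕ.+ i)) n + f (m ℕ.+ n))     ∎

  ∑-scale : ∀ n k f → ∑ (λ i → k * f i) n ≈ k * ∑ f n
  ∑-scale zero    k f = sym (zeroʳ k)
  ∑-scale (suc n) k f = trans (+-congʳ (∑-scale n k f)) (sym (distribˡ k _ _))

  dc-term : Carrier → Carrier → ℕ → ℕ → ℕ → Carrier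
  dc-term U V a b₀ i = U ^ (suc i ℕ.* a / suc b₀) * V ^ i

  dcSum≡∑ : ∀ U V a b₀ m → dcSum R U V a b₀ m ≡ ∑ (dc-term U V a b₀) m
  dcSum≡∑ U V a b₀ zero    = ≡.refl
  dcSum≡∑ U V a b₀ (suc m) = ≡.cong (_+ dc-term U V a b₀ m) (dcSum≡∑ U V a b₀ m)

  dc≡∑ : ∀ U V a b₀ → dc R U V a (suc b₀) ≡ ∑ (dc-term U V a b₀) b₀
  dc≡∑ U V a b₀ = dcSum≡∑ U V a b₀ b₀

  dc-from-zero : ∀ U V l₁ l₂ →
    ∑ (λ j → U ^ (j ℕ.* l₁ / suc l₂) * V ^ j) (suc l₂) ≈ 1# + V * dc R U V l₁ (suc l₂)
  dc-from-zero U V l₁ l₂ = begin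
    ∑ h (suc l₂)                                  ≈⟨ ∑-split 1 l₂ h ⟩
    (0# + 1# * 1#) + ∑ (λ j → h (suc j)) l₂       ≈⟨ +-cong (trans (+-identityˡ _) (*-identityˡ 1#))
                                                     (∑-cong l₂ (λ j _ → x∙yz≈y∙xz _ V (V ^ j))) ⟩
    1# + ∑ (λ j → V * dc-term U V l₁ l₂ j) l₂     ≈⟨ +-congˡ (∑-scale l₂ V (dc-term U V l₁ l₂)) ⟩
    1# + V * ∑ (dc-term U V l₁ l₂) l₂             ≡⟨ ≡.cong (λ x → 1# + V * x) (dc≡∑ U V l₁ l₂) ⟨
    1# + V * dc R U V l₁ (suc l₂)                 ∎
    where
    h : ℕ → Carrier
    h j = U ^ (j ℕ.* l₁ / suc l₂) * V ^ j

  dc-mediant : ∀ U V s₁ s₂ l₁ l₂ → l₁ ℕ.* suc s₂ ≡ suc l₂ ℕ.* s₁ ℕ.+ 1 →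
    dc R U V (s₁ ℕ.+ l₁) (suc s₂ ℕ.+ suc l₂)
      ≈ dc R U V s₁ (suc s₂) + (U ^ s₁ * V ^ s₂) * (1# + V * dc R U V l₁ (suc l₂))
  dc-mediant U V s₁ s₂ l₁ l₂ det = begin
    dc R U V (s₁ ℕ.+ l₁) (suc s₂ ℕ.+ suc l₂)                ≡⟨ dc≡∑ U V (s₁ ℕ.+ l₁) (s₂ ℕ.+ suc l₂) ⟩
    ∑ t (s₂ ℕ.+ suc l₂)                                      ≈⟨ ∑-split s₂ (suc l₂) t ⟩
    ∑ t s₂ + ∑ (λ j → t (s₂ ℕ.+ j)) (suc l₂)                 ≈⟨ +-cong (∑-cong s₂ head) (∑-cong (suc l₂) tail) ⟩
    ∑ (dc-term U V s₁ s₂) s₂ + ∑ (λ j → P * h j) (suc l₂)    ≈⟨ +-congˡ (∑-scale (suc l₂) P h) ⟩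
    ∑ (dc-term U V s₁ s₂) s₂ + P * ∑ h (suc l₂)              ≈⟨ +-cong (reflexive (≡.sym (dc≡∑ U V s₁ s₂)))
                                                                       (*-congˡ (dc-from-zero U V l₁ l₂)) ⟩
    dc R U V s₁ (suc s₂) + P * (1# + V * dc R U V l₁ (suc l₂)) ∎
    where
    t : ℕ → Carrier
    t = dc-term U V (s₁ ℕ.+ l₁) (s₂ ℕ.+ suc l₂)
    P : Carrier
    P = U ^ s₁ * V ^ s₂
    h : ℕ → Carrier
    h j = U ^ (j ℕ.* l₁ / suc l₂) * V ^ j
    head : ∀ i → i < s₂ → t i ≈ dc-term U V s₁ s₂ i
    head i i<s₂ = *-congʳ (reflexive (≡.cong (U ^_)
      (floor-mediant-head s₁ s₂ l₁ (suc l₂) (suc i) det (s≤s i<s₂))))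
    tail : ∀ j → j < suc l₂ → t (s₂ ℕ.+ j) ≈ P * h j
    tail j j<L₂ = begin
      t (s₂ ℕ.+ j)                                       ≡⟨ ≡.cong (λ e → U ^ e * V ^ (s₂ ℕ.+ j))
                                                              (floor-mediant-tail s₁ s₂ l₁ l₂ j det j<L₂) ⟩
      U ^ (s₁ ℕ.+ j ℕ.* l₁ / suc l₂) * V ^ (s₂ ℕ.+ j)    ≈⟨ *-cong (^-homo-* U s₁ _) (^-homo-* V s₂ j) ⟩
      (U ^ s₁ * U ^ (j ℕ.* l₁ / suc l₂)) * (V ^ s₂ * V ^ j) ≈⟨ interchange _ _ _ _ ⟩
      P * h j                                             ∎

  -- For a = 1 all floors vanish and c(U,V;1,n+1) is a geometric sum.
  dc-one : ∀ U V n → dc R U V 1 (suc n) ≈ ∑ (V ^_) n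
  dc-one U V n = trans (reflexive (dc≡∑ U V 1 n)) (∑-cong n λ i i<n → begin
    U ^ (suc i ℕ.* 1 / suc n) * V ^ i  ≡⟨ ≡.cong (λ e → U ^ e * V ^ i) (m<n⇒m/n≡0 (below i i<n)) ⟩
    1# * V ^ i                         ≈⟨ *-identityˡ _ ⟩
    V ^ i                              ∎)
    where
    below : ∀ i → i < n → suc i ℕ.* 1 < suc n
    below i i<n = ≡.subst (_< suc n) (≡.sym (ℕ.*-identityʳ (suc i))) (s≤s i<n)

  geometric-empty : ∀ V → geometricDefect V 1# 0# ≈ 0#
  geometric-empty = solve 1 (λ V → E.geometricDefect 1 V (con (+ 1)) (con (+ 0)) := con (+ 0)) refl

  geometric-step : ∀ V P G → geometricDefect V (V * P) (G + P) ≈ geometricDefect V P G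
  geometric-step = solve 3 (λ V P G →
    E.geometricDefect 3 V (V :* P) (G :+ P) := E.geometricDefect 3 V P G) refl

  geometric : ∀ V n → geometricDefect V (V ^ n) (∑ (V ^_) n) ≈ 0#
  geometric V zero    = geometric-empty V
  geometric V (suc n) = trans (geometric-step V (V ^ n) (∑ (V ^_) n)) (geometric V n)

  recipDefect-cong : ∀ {u v A A′ B B′ X X′ Y Y′} → A ≈ A′ → B ≈ B′ → X ≈ X′ → Y ≈ Y′ →
    recipDefect u v A B X Y ≈ recipDefect u v A′ B′ X′ Y′
  recipDefect-cong A≈ B≈ X≈ Y≈ =
    +-cong (+-cong (*-congˡ X≈) (*-congˡ Y≈)) (-‿cong (+-congʳ (*-cong A≈ B≈)))

  crossRHS-cong : ∀ {F F′ u v A A′ B B′ C C′ D D′} →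
    F ≈ F′ → A ≈ A′ → B ≈ B′ → C ≈ C′ → D ≈ D′ →
    crossRHS F u v A B C D ≈ crossRHS F′ u v A′ B′ C′ D′
  crossRHS-cong F≈ A≈ B≈ C≈ D≈ =
    +-congʳ (+-cong (+-cong (+-cong (+-cong (+-cong (+-cong F≈
      (-‿cong (*-cong (*-congˡ A≈) (*-congˡ B≈))))
      (-‿cong (*-cong (*-congˡ C≈) (*-congˡ D≈))))
      (*-cong A≈ (*-congˡ B≈)))
      (*-cong (*-congˡ C≈) D≈))
      (-‿cong (*-cong A≈ B≈)))
      (-‿cong (*-cong C≈ D≈)))

  crossDefect-cong : ∀ {u v A A′ B B′ C C′ D D′ X X′ Y Y′} →
    A ≈ A′ → B ≈ B′ → C ≈ C′ → D ≈ D′ → X ≈ X′ → Y ≈ Y′ →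
    crossDefect u v A B C D X Y ≈ crossDefect u v A′ B′ C′ D′ X′ Y′
  crossDefect-cong A≈ B≈ C≈ D≈ X≈ Y≈ = +-cong
    (+-cong (*-cong (*-congˡ (+-congʳ (*-cong (*-congˡ A≈) (*-congˡ B≈)))) Y≈)
            (*-cong (*-congˡ (+-congʳ (*-cong (*-congˡ C≈) (*-congˡ D≈)))) X≈))
    (-‿cong (crossRHS-cong (*-cong (*-cong A≈ (*-congˡ C≈)) (*-cong B≈ (*-congˡ D≈))) A≈ B≈ C≈ D≈))

  -- The defects of the mediant pairs as combinations of the defects of the
  -- pair (a,b) = "L", (c,d) = "S"; the mediant has powers u·(C·A), v·(D·B).
  recip-mediant : ∀ u v A B C D XL YL XS YS →
    recipDefect u v (u * (C * A)) (v * (D * B))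
      (XS + (u * C) * D * (1# + v * XL)) (YL + (v * B) * A * (1# + u * YS))
    ≈ recipDefect u v C D XS YS + recipDefect u v A B XL YL + crossDefect u v A B C D XL YS
  recip-mediant = solve 10 (λ u v A B C D XL YL XS YS →
    E.recipDefect 10 u v (u :* (C :* A)) (v :* (D :* B))
      (XS :+ (u :* C) :* D :* (con (+ 1) :+ v :* XL)) (YL :+ (v :* B) :* A :* (con (+ 1) :+ u :* YS))
    := E.recipDefect 10 u v C D XS YS :+ E.recipDefect 10 u v A B XL YL
         :+ E.crossDefect 10 u v A B C D XL YS) refl

  cross-left : ∀ u v A B C D XL XS YS →
    crossDefect u v (u * (C * A)) (v * (D * B)) C D (XS + (u * C) * D * (1# + v * XL)) YS
    ≈ ((u * C) * (v * D) - 1#) * recipDefect u v C D XS YS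
        + ((u * C) * (v * D)) * crossDefect u v A B C D XL YS
  cross-left = solve 9 (λ u v A B C D XL XS YS →
    E.crossDefect 9 u v (u :* (C :* A)) (v :* (D :* B)) C D (XS :+ (u :* C) :* D :* (con (+ 1) :+ v :* XL)) YS
    := ((u :* C) :* (v :* D) :- con (+ 1)) :* E.recipDefect 9 u v C D XS YS
         :+ ((u :* C) :* (v :* D)) :* E.crossDefect 9 u v A B C D XL YS) refl

  cross-right : ∀ u v A B C D XL YL YS →
    crossDefect u v A B (u * (C * A)) (v * (D * B)) XL (YL + (v * B) * A * (1# + u * YS))
    ≈ ((u * A) * (v * B) - 1#) * recipDefect u v A B XL YL
        + ((u * A) * (v * B)) * crossDefect u v A B C D XL YS
  cross-right = solve 9 (λ u v A B C D XL YL YS →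
    E.crossDefect 9 u v A B (u :* (C :* A)) (v :* (D :* B)) XL (YL :+ (v :* B) :* A :* (con (+ 1) :+ u :* YS))
    := ((u :* A) :* (v :* B) :- con (+ 1)) :* E.recipDefect 9 u v A B XL YL
         :+ ((u :* A) :* (v :* B)) :* E.crossDefect 9 u v A B C D XL YS) refl

  recip-base-u : ∀ u v P G → recipDefect u v P 1# 0# G ≈ geometricDefect u P G
  recip-base-u = solve 4 (λ u v P G →
    E.recipDefect 4 u v P (con (+ 1)) (con (+ 0)) G := E.geometricDefect 4 u P G) refl

  recip-base-v : ∀ u v Q G → recipDefect u v 1# Q G 0# ≈ geometricDefect v Q G
  recip-base-v = solve 4 (λ u v Q G →
    E.recipDefect 4 u v (con (+ 1)) Q G (con (+ 0)) := E.geometricDefect 4 v Q G) refl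

  cross-base-u : ∀ u v C G →
    crossDefect u v (u * C) 1# C 1# 0# G ≈ ((u * (u * C)) * (v * 1#) - 1#) * geometricDefect u C G
  cross-base-u = solve 4 (λ u v C G →
    E.crossDefect 4 u v (u :* C) (con (+ 1)) C (con (+ 1)) (con (+ 0)) G
    := ((u :* (u :* C)) :* (v :* con (+ 1)) :- con (+ 1)) :* E.geometricDefect 4 u C G) refl

  cross-base-v : ∀ u v B G →
    crossDefect u v 1# B 1# (v * B) G 0# ≈ ((u * 1#) * (v * (v * B)) - 1#) * geometricDefect v B G
  cross-base-v = solve 4 (λ u v B G →
    E.crossDefect 4 u v (con (+ 1)) B (con (+ 1)) (v :* B) G (con (+ 0))
    := ((u :* con (+ 1)) :* (v :* (v :* B)) :- con (+ 1)) :* E.geometricDefect 4 v B G) refl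

  scaled : ∀ k {d} → d ≈ 0# → k * d ≈ 0#
  scaled k d≈0 = trans (*-congˡ d≈0) (zeroʳ k)

  added : ∀ {d e} → d ≈ 0# → e ≈ 0# → d + e ≈ 0#
  added d≈0 e≈0 = trans (+-cong d≈0 e≈0) (+-identityʳ 0#)

  module Reciprocity (u v : Carrier) where

    Recip : ℕ → ℕ → Set ℓ
    Recip a₀ b₀ =
      recipDefect u v (u ^ a₀) (v ^ b₀) (dc R u v (suc a₀) (suc b₀)) (dc R v u (suc b₀) (suc a₀)) ≈ 0#

    Cross : ℕ → ℕ → ℕ → ℕ → Set ℓ
    Cross a₀ b₀ c₀ d₀ =
      crossDefect u v (u ^ a₀) (v ^ b₀) (u ^ c₀) (v ^ d₀)
        (dc R u v (suc a₀) (suc b₀)) (dc R v u (suc d₀) (suc c₀)) ≈ 0#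

    record Invariant (a₀ b₀ c₀ d₀ : ℕ) : Set ℓ where
      field
        recip-large : Recip a₀ b₀
        recip-small : Recip c₀ d₀
        cross       : Cross a₀ b₀ c₀ d₀
    open Invariant

    mediant-power : ∀ w m n → w ^ suc (m ℕ.+ n) ≈ w * (w ^ m * w ^ n)
    mediant-power w m n = *-congˡ (^-homo-* w m n)

    mediant-index : ∀ m n → suc (suc (m ℕ.+ n)) ≡ suc m ℕ.+ suc n
    mediant-index m n = ≡.cong suc (≡.sym (ℕ.+-suc m n))

    mediant-X : ∀ a₀ b₀ c₀ d₀ → Unimodular a₀ b₀ c₀ d₀ →
      dc R u v (suc (suc (c₀ ℕ.+ a₀))) (suc (suc (d₀ ℕ.+ b₀)))
        ≈ dc R u v (suc c₀) (suc d₀) + (u * u ^ c₀) * v ^ d₀ * (1# + v * dc R u v (suc a₀) (suc b₀))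
    mediant-X a₀ b₀ c₀ d₀ det =
      trans (reflexive (≡.cong₂ (dc R u v) (mediant-index c₀ a₀) (mediant-index d₀ b₀)))
            (dc-mediant u v (suc c₀) d₀ (suc a₀) b₀ det)

    mediant-Y : ∀ a₀ b₀ c₀ d₀ → Unimodular a₀ b₀ c₀ d₀ →
      dc R v u (suc (suc (d₀ ℕ.+ b₀))) (suc (suc (c₀ ℕ.+ a₀)))
        ≈ dc R v u (suc b₀) (suc a₀) + (v * v ^ b₀) * u ^ a₀ * (1# + u * dc R v u (suc d₀) (suc c₀))
    mediant-Y a₀ b₀ c₀ d₀ det =
      trans (reflexive (≡.cong₂ (dc R v u) (swapped d₀ b₀) (swapped c₀ a₀)))
            (dc-mediant v u (suc b₀) a₀ (suc d₀) c₀ det′)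
      where
      swapped : ∀ m n → suc (suc (m ℕ.+ n)) ≡ suc n ℕ.+ suc m
      swapped m n = ≡.trans (≡.cong (λ x → suc (suc x)) (ℕ.+-comm m n)) (mediant-index n m)
      det′ : suc d₀ ℕ.* suc a₀ ≡ suc c₀ ℕ.* suc b₀ ℕ.+ 1
      det′ = ≡.trans (ℕ.*-comm (suc d₀) (suc a₀))
               (≡.trans det (≡.cong (ℕ._+ 1) (ℕ.*-comm (suc b₀) (suc c₀))))

    mediant-recip : ∀ {a₀ b₀ c₀ d₀} → Unimodular a₀ b₀ c₀ d₀ → Invariant a₀ b₀ c₀ d₀ →
      Recip (suc (c₀ ℕ.+ a₀)) (suc (d₀ ℕ.+ b₀))
    mediant-recip {a₀} {b₀} {c₀} {d₀} det inv = begin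
      recipDefect u v (u ^ suc (c₀ ℕ.+ a₀)) (v ^ suc (d₀ ℕ.+ b₀)) _ _
        ≈⟨ recipDefect-cong (mediant-power u c₀ a₀) (mediant-power v d₀ b₀) (mediant-X a₀ b₀ c₀ d₀ det) (mediant-Y a₀ b₀ c₀ d₀ det) ⟩
      _ ≈⟨ recip-mediant u v (u ^ a₀) (v ^ b₀) (u ^ c₀) (v ^ d₀) _ _ _ _ ⟩
      _ ≈⟨ added (added (recip-small inv) (recip-large inv)) (cross inv) ⟩
      0# ∎

    invariant-left : ∀ {a₀ b₀ c₀ d₀} → Unimodular a₀ b₀ c₀ d₀ → Invariant a₀ b₀ c₀ d₀ →
      Invariant (suc (c₀ ℕ.+ a₀)) (suc (d₀ ℕ.+ b₀)) c₀ d₀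
    invariant-left {a₀} {b₀} {c₀} {d₀} det inv = record
      { recip-large = mediant-recip det inv
      ; recip-small = recip-small inv
      ; cross       = begin
          crossDefect u v (u ^ suc (c₀ ℕ.+ a₀)) (v ^ suc (d₀ ℕ.+ b₀)) (u ^ c₀) (v ^ d₀) _ _
            ≈⟨ crossDefect-cong (mediant-power u c₀ a₀) (mediant-power v d₀ b₀) refl refl (mediant-X a₀ b₀ c₀ d₀ det) refl ⟩
          _ ≈⟨ cross-left u v (u ^ a₀) (v ^ b₀) (u ^ c₀) (v ^ d₀) _ _ _ ⟩
          _ ≈⟨ added (scaled _ (recip-small inv)) (scaled _ (cross inv)) ⟩
          0# ∎
      }

    invariant-right : ∀ {a₀ b₀ c₀ d₀} → Unimodular a₀ b₀ c₀ d₀ → Invariant a₀ b₀ c₀ d₀ →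
      Invariant a₀ b₀ (suc (c₀ ℕ.+ a₀)) (suc (d₀ ℕ.+ b₀))
    invariant-right {a₀} {b₀} {c₀} {d₀} det inv = record
      { recip-large = recip-large inv
      ; recip-small = mediant-recip det inv
      ; cross       = begin
          crossDefect u v (u ^ a₀) (v ^ b₀) (u ^ suc (c₀ ℕ.+ a₀)) (v ^ suc (d₀ ℕ.+ b₀)) _ _
            ≈⟨ crossDefect-cong refl refl (mediant-power u c₀ a₀) (mediant-power v d₀ b₀) refl (mediant-Y a₀ b₀ c₀ d₀ det) ⟩
          _ ≈⟨ cross-right u v (u ^ a₀) (v ^ b₀) (u ^ c₀) (v ^ d₀) _ _ _ ⟩
          _ ≈⟨ added (scaled _ (recip-large inv)) (scaled _ (cross inv)) ⟩
          0# ∎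
      }

    invariant-integers : ∀ n → Invariant (suc n) 0 n 0
    invariant-integers n = record
      { recip-large = base-recip (suc n)
      ; recip-small = base-recip n
      ; cross       = trans (crossDefect-cong refl refl refl refl refl (dc-one v u n))
                        (trans (cross-base-u u v (u ^ n) _) (scaled _ (geometric u n)))
      }
      where
      base-recip : ∀ m → Recip m 0
      base-recip m = trans (recipDefect-cong refl refl refl (dc-one v u m))
                       (trans (recip-base-u u v (u ^ m) _) (geometric u m))

    invariant-unit-fractions : ∀ n → Invariant 0 n 0 (suc n)
    invariant-unit-fractions n = record
      { recip-large = base-recip n
      ; recip-small = base-recip (suc n)
      ; cross       = trans (crossDefect-cong refl refl refl refl (dc-one u v n) refl)
                        (trans (cross-base-v u v (v ^ n) _) (scaled _ (geometric v n)))
      }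
      where
      base-recip : ∀ m → Recip 0 m
      base-recip m = trans (recipDefect-cong refl refl (dc-one u v m) refl)
                       (trans (recip-base-v u v (v ^ m) _) (geometric v m))

    invariant : ∀ {a₀ b₀ c₀ d₀} → SternBrocot a₀ b₀ c₀ d₀ → Invariant a₀ b₀ c₀ d₀
    invariant (integers n)            = invariant-integers n
    invariant (unit-fractions n)      = invariant-unit-fractions n
    invariant (mediant-left det d)    = invariant-left det (invariant d)
    invariant (mediant-right det d)   = invariant-right det (invariant d)

-- The Cross component of the invariant is the statement, once the leading
-- power u^(a+c-1) v^(b+d-1) is split as (u^(a-1) uᶜ)(v^(b-1) vᵈ).
corollary10 : {ℓc ℓ : Level} (R : CommutativeRing ℓc ℓ) →
    let open CommutativeRing R in
    (a b c d : ℕ) → 0 < a → 0 < b → 0 < c → 0 < d →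
    a *ℕ d ≡ b *ℕ c +ℕ 1 →
    (u v : Carrier) →
    let _^'_ = pow R in
    ((u - 1#) * ((u ^' a) * (v ^' b) - 1#)) * dc R v u d c
    + ((v - 1#) * ((u ^' c) * (v ^' d) - 1#)) * dc R u v a b
    ≈ (u ^' ((a +ℕ c) ∸ 1)) * (v ^' ((b +ℕ d) ∸ 1))
    - (u ^' a) * (v ^' b)
    - (u ^' c) * (v ^' d)
    + (u ^' (a ∸ 1)) * (v ^' b)
    + (u ^' c) * (v ^' (d ∸ 1))
    - (u ^' (a ∸ 1)) * (v ^' (b ∸ 1))
    - (u ^' (c ∸ 1)) * (v ^' (d ∸ 1))
    + 1#
corollary10 R (suc a₀) (suc b₀) (suc c₀) (suc d₀) _ _ _ _ unimodular u v =
  trans (x∙y⁻¹≈ε⇒x≈y _ _ (Invariant.cross (invariant (sternBrocot a₀ b₀ c₀ d₀ unimodular))))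
        (crossRHS-cong (sym (*-cong (^-homo-* u a₀ (suc c₀)) (^-homo-* v b₀ (suc d₀)))) refl refl refl refl)
  where
  open CommutativeRing R
  open import Algebra.Properties.Ring ring using (x∙y⁻¹≈ε⇒x≈y)
  open import Algebra.Properties.Semiring.Exp semiring using (^-homo-*)
  open DedekindCarlitz R using (crossRHS-cong; module Reciprocity)
  open Reciprocity u v using (Invariant; invariant)
  open SternBrocotPairs using (sternBrocot)
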